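{- Let $n\ge 2$ and let $F_1,\ldots,F_n$ be finite fields with $|F_1|\le\cdots\le|F_n|$. Suppose that one of the following holds: (i) $F_1$ has even characteristic; (ii) every $F_i$ has odd characteristic and $F_1\times F_2\not\cong\mathbb{Z}_3\times\mathbb{Z}_3$. Then $\chi\big(T(\Gamma(F_1\times\cdots\times F_n))\big)=|F_2|\cdots|F_n|$.
   Context: For a commutative ring $R$ with unity, $Z(R)$ is the set of zero-divisors (including $0$). The total graph $T(\Gamma(R))$ is the simple graph with vertex set $R$ in which distinct $x,y$ are adjacent iff $x+y\in Z(R)$. $\chi$ denotes chromatic number. -}

module Defs where

open import Level using (Level; _⊔_)
open import Data.Nat using (ℕ; zero; suc; _≤_; _<_; s≤s; z≤n)
open import Data.Nat.Divisibility using (_∣_)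
open import Data.Fin using (Fin; fromℕ<; zero; suc; toℕ) renaming (_≤_ to _≤ᶠ_)
import Data.Fin as Fin
open import Data.Product using (Σ; ∃; _×_; _,_; proj₁; proj₂)
open import Relation.Nullary using (¬_)
open import Relation.Binary.PropositionalEquality using (_≡_; _≢_)
import Relation.Binary.PropositionalEquality as ≡
open import Algebra.Bundles using (CommutativeRing)
open import Function.Bundles using (Bijection)

record Field (c ℓ : Level) : Set (Level.suc (c ⊔ ℓ)) where
  field
    commRing : CommutativeRing c ℓ
  open CommutativeRing commRing public
  field
    1≉0     : ¬ (1# ≈ 0#)
    inverse : ∀ x → ¬ (x ≈ 0#) → Σ Carrier λ y → x * y ≈ 1#

record FiniteField (c ℓ : Level) : Set (Level.suc (c ⊔ ℓ)) where
  field
    field'    : Field c ℓ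
    size      : ℕ
    enumerate : Bijection (CommutativeRing.setoid (Field.commRing field')) (≡.setoid (Fin size))
  open Field field' public

∣_∣ : ∀ {c ℓ} → FiniteField c ℓ → ℕ
∣ F ∣ = FiniteField.size F

natTimes1 : ∀ {c ℓ} (F : Field c ℓ) → ℕ → Field.Carrier F
natTimes1 F zero    = Field.0# F
natTimes1 F (suc k) = Field._+_ F (Field.1# F) (natTimes1 F k)

HasCharacteristic : ∀ {c ℓ} → Field c ℓ → ℕ → Set ℓ
HasCharacteristic F p =
  (0 < p) × Field._≈_ F (natTimes1 F p) (Field.0# F)
  × (∀ k → 0 < k → k < p → ¬ Field._≈_ F (natTimes1 F k) (Field.0# F))

EvenCharacteristic : ∀ {c ℓ} → Field c ℓ → Set ℓ
EvenCharacteristic F = ∃ λ p → HasCharacteristic F p × (2 ∣ p)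

OddCharacteristic : ∀ {c ℓ} → Field c ℓ → Set ℓ
OddCharacteristic F = ∃ λ p → HasCharacteristic F p × ¬ (2 ∣ p)

module Product {c ℓ : Level} {n : ℕ} (F : Fin n → FiniteField c ℓ) where

  Elt : Set c
  Elt = (i : Fin n) → FiniteField.Carrier (F i)

  _≈ᴾ_ : Elt → Elt → Set ℓ
  x ≈ᴾ y = ∀ i → FiniteField._≈_ (F i) (x i) (y i)

  0ᴾ : Elt
  0ᴾ i = FiniteField.0# (F i)

  _+ᴾ_ : Elt → Elt → Elt
  (x +ᴾ y) i = FiniteField._+_ (F i) (x i) (y i)

  _*ᴾ_ : Elt → Elt → Elt
  (x *ᴾ y) i = FiniteField._*_ (F i) (x i) (y i)

  -- Z(R): zero-divisors (including 0)
  ZeroDivisor : Elt → Set (c ⊔ ℓ)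
  ZeroDivisor x = Σ Elt λ y → ¬ (y ≈ᴾ 0ᴾ) × ((x *ᴾ y) ≈ᴾ 0ᴾ)

  Adjacent : Elt → Elt → Set (c ⊔ ℓ)
  Adjacent x y = ¬ (x ≈ᴾ y) × ZeroDivisor (x +ᴾ y)

  record ProperColouring (k : ℕ) : Set (c ⊔ ℓ) where
    field
      colour : Elt → Fin k
      respects : ∀ {x y} → x ≈ᴾ y → colour x ≡ colour y
      proper : ∀ {x y} → Adjacent x y → colour x ≢ colour y

  ChromaticNumberIs : ℕ → Set (c ⊔ ℓ)
  ChromaticNumberIs m = ProperColouring m × (∀ k → k < m → ¬ ProperColouring k)

_+₃_ : Fin 3 → Fin 3 → Fin 3
(zero) +₃ (zero) = zero
(zero) +₃ (suc zero) = suc zero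
(zero) +₃ (suc (suc zero)) = suc (suc zero)
(suc zero) +₃ (zero) = suc zero
(suc zero) +₃ (suc zero) = suc (suc zero)
(suc zero) +₃ (suc (suc zero)) = zero
(suc (suc zero)) +₃ (zero) = suc (suc zero)
(suc (suc zero)) +₃ (suc zero) = zero
(suc (suc zero)) +₃ (suc (suc zero)) = suc zero

_*₃_ : Fin 3 → Fin 3 → Fin 3
(zero) *₃ (zero) = zero
(zero) *₃ (suc zero) = zero
(zero) *₃ (suc (suc zero)) = zero
(suc zero) *₃ (zero) = zero
(suc zero) *₃ (suc zero) = suc zero
(suc zero) *₃ (suc (suc zero)) = suc (suc zero)
(suc (suc zero)) *₃ (zero) = zero
(suc (suc zero)) *₃ (suc zero) = suc (suc zero)
(suc (suc zero)) *₃ (suc (suc zero)) = suc zero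

Z3×Z3 : Set
Z3×Z3 = Fin 3 × Fin 3

record IsoToZ3×Z3 {c ℓ} (F G : FiniteField c ℓ) : Set (c ⊔ ℓ) where
  module F = FiniteField F
  module G = FiniteField G
  _≈₂_ : F.Carrier × G.Carrier → F.Carrier × G.Carrier → Set ℓ
  (a , b) ≈₂ (a' , b') = F._≈_ a a' × G._≈_ b b'
  field
    φ          : F.Carrier × G.Carrier → Z3×Z3
    φ-cong     : ∀ {x y} → x ≈₂ y → φ x ≡ φ y
    φ-injective : ∀ {x y} → φ x ≡ φ y → x ≈₂ y
    φ-surjective : ∀ z → Σ (F.Carrier × G.Carrier) λ x → φ x ≡ z
    φ-+ : ∀ a b a' b' → φ (F._+_ a a' , G._+_ b b')
            ≡ (proj₁ (φ (a , b)) +₃ proj₁ (φ (a' , b')) , proj₂ (φ (a , b)) +₃ proj₂ (φ (a' , b')))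
    φ-* : ∀ a b a' b' → φ (F._*_ a a' , G._*_ b b')
            ≡ (proj₁ (φ (a , b)) *₃ proj₁ (φ (a' , b')) , proj₂ (φ (a , b)) *₃ proj₂ (φ (a' , b')))
    φ-0 : φ (F.0# , G.0#) ≡ (zero , zero)
    φ-1 : φ (F.1# , G.1#) ≡ (suc zero , suc zero)

_≅Z3×Z3 : ∀ {c ℓ} → FiniteField c ℓ × FiniteField c ℓ → Set (c ⊔ ℓ)
(F , G) ≅Z3×Z3 = IsoToZ3×Z3 F G

-- Lower bound: the elements with first coordinate 0 pairwise sum to zero divisors, so they
-- form a clique of size |F₂|⋯|Fₙ|.
--
-- Upper bound: x is coloured by a tuple in F₂ × ⋯ × Fₙ built from a label ℓ(x) depending on
-- (x₁, x₂): each later entry recolours x_j by an injection indexed by ℓ(x), the injections being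
-- chosen so that two with different indices never give a and −a the same colour. Equal tuples
-- then force either equal labels, hence x = y, or x_i + y_i ≠ 0 in every coordinate, so x + y is
-- a unit. In characteristic 2, translations do. In odd characteristic negation looks like
-- 0, ±1, …, ±k, and the transpositions (0 i) and 4-cycles (0 −i −i′ i) do when |F| ≥ 5, or for
-- at most two labels when |F| = 3. If F₁ has characteristic 2, the label is x₁ and x₂ is
-- recoloured like the later entries. If F₁ and F₂ are odd, an explicit bijection
-- F₁ × F₂ → F₂ × F₂, (x₁, x₂) ↦ (colour, label), with the same separation property exists once
-- |F₂| ≥ 5; otherwise both fields have three elements and F₁ × F₂ ≅ ℤ₃ × ℤ₃.

module Submission where

open import Defs
open import Data.Nat using (ℕ; _≤_)
open import Data.Nat.Properties using (≤-trans; n≤1+n)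
open import Data.Fin using (Fin; fromℕ<; toℕ)
open import Data.Product using (_×_; _,_)
open import Data.Sum using (_⊎_)
open import Data.List using (List; map; drop; allFin)
open import Data.Nat.ListAction using (product)
open import Relation.Nullary using (¬_)
open import Level using (Level)
open import Data.Nat using (suc; s≤s; z≤n)
open import Data.Fin using (zero; suc)
open import Data.Sum using (inj₁; inj₂)
open import Function using (_∘_)

module DecidableSubsets where

  open import Data.Nat using (zero)
  open import Data.Fin.Properties using (suc-injective)
  open import Relation.Nullary using (yes; no; contradiction)
  open import Relation.Unary using (Decidable)
  open import Relation.Binary.PropositionalEquality using (_≡_; refl; cong)

  count : ∀ {n} {P : Fin n → Set} → Decidable P → ℕ
  count {zero}  P? = 0
  count {suc n} P? with P? zero
  ... | yes _ = suc (count (P? ∘ suc))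
  ... | no _  = count (P? ∘ suc)

  element : ∀ {n} {P : Fin n → Set} (P? : Decidable P) → Fin (count P?) → Fin n
  element {suc n} P? i with P? zero
  element {suc n} P? zero    | yes _ = zero
  element {suc n} P? (suc i) | yes _ = suc (element (P? ∘ suc) i)
  element {suc n} P? i       | no _  = suc (element (P? ∘ suc) i)

  element-satisfies : ∀ {n} {P : Fin n → Set} (P? : Decidable P) i → P (element P? i)
  element-satisfies {suc n} P? i with P? zero
  element-satisfies {suc n} P? zero    | yes p = p
  element-satisfies {suc n} P? (suc i) | yes _ = element-satisfies (P? ∘ suc) i
  element-satisfies {suc n} P? i       | no _  = element-satisfies (P? ∘ suc) i

  index : ∀ {n} {P : Fin n → Set} (P? : Decidable P) x → P x → Fin (count P?)
  index {suc n} P? zero    p with P? zero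
  ... | yes _ = zero
  ... | no ¬p = contradiction p ¬p
  index {suc n} P? (suc x) p with P? zero
  ... | yes _ = suc (index (P? ∘ suc) x p)
  ... | no _  = index (P? ∘ suc) x p

  element-index : ∀ {n} {P : Fin n → Set} (P? : Decidable P) x (p : P x) → element P? (index P? x p) ≡ x
  element-index {suc n} P? zero    p with P? zero
  ... | yes _ = refl
  ... | no ¬p = contradiction p ¬p
  element-index {suc n} P? (suc x) p with P? zero
  ... | yes _ = cong suc (element-index (P? ∘ suc) x p)
  ... | no _  = cong suc (element-index (P? ∘ suc) x p)

  element-injective : ∀ {n} {P : Fin n → Set} (P? : Decidable P) {i j} → element P? i ≡ element P? j → i ≡ j
  element-injective {suc n} P? {i} {j} eq with P? zero
  element-injective {suc n} P? {zero}  {zero}  eq | yes _ = refl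
  element-injective {suc n} P? {suc i} {suc j} eq | yes _ = cong suc (element-injective (P? ∘ suc) (suc-injective eq))
  element-injective {suc n} P? {i}     {j}     eq | no _  = element-injective (P? ∘ suc) (suc-injective eq)

  index-element : ∀ {n} {P : Fin n → Set} (P? : Decidable P) i (p : P (element P? i)) → index P? (element P? i) p ≡ i
  index-element P? i p = element-injective P? (element-index P? (element P? i) p)

-- The normal form of negation on a finite field of odd order: 0 and the pairs ±i.
module SignedSets where

  open import Data.Nat using (zero; _+_)
  open import Data.Fin using (inject≤; _↑ˡ_; _↑ʳ_; splitAt; join)
  open import Data.Fin.Properties using (inject≤-injective; splitAt-↑ˡ; splitAt-↑ʳ; join-splitAt)
  open import Data.Sum using ([_,_]′)
  open import Data.Bool using (Bool; true; false)
  open import Relation.Nullary using (contradiction)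
  open import Relation.Binary.PropositionalEquality using (_≡_; _≢_; refl; cong; trans; sym; subst)

  data Signed (k : ℕ) : Set where
    zero    : Signed k
    pos neg : Fin k → Signed k

  module _ {k : ℕ} where

    pos-injective : ∀ {i j : Fin k} → pos i ≡ pos j → i ≡ j
    pos-injective refl = refl

    neg-injective : ∀ {i j : Fin k} → neg i ≡ neg j → i ≡ j
    neg-injective refl = refl

    -ˢ_ : Signed k → Signed k
    -ˢ zero  = zero
    -ˢ pos i = neg i
    -ˢ neg i = pos i

    -ˢ-fixed⇒zero : ∀ {x} → -ˢ x ≡ x → x ≡ zero
    -ˢ-fixed⇒zero {zero} _ = refl

    toFin : Signed k → Fin (suc (k + k))
    toFin zero    = zero
    toFin (pos i) = suc (i ↑ˡ k)
    toFin (neg i) = suc (k ↑ʳ i)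

    fromFin : Fin (suc (k + k)) → Signed k
    fromFin zero    = zero
    fromFin (suc i) = [ pos , neg ]′ (splitAt k i)

    fromFin-toFin : ∀ x → fromFin (toFin x) ≡ x
    fromFin-toFin zero    = refl
    fromFin-toFin (pos i) = cong [ pos , neg ]′ (splitAt-↑ˡ k i k)
    fromFin-toFin (neg i) = cong [ pos , neg ]′ (splitAt-↑ʳ k k i)

    toFin-fromFin : ∀ i → toFin (fromFin i) ≡ i
    toFin-fromFin zero    = refl
    toFin-fromFin (suc i) = trans (toFin-[pos,neg] (splitAt k i)) (cong suc (join-splitAt k k i))
      where
      toFin-[pos,neg] : ∀ s → toFin ([ pos , neg ]′ s) ≡ suc (join k k s)
      toFin-[pos,neg] (inj₁ j) = refl
      toFin-[pos,neg] (inj₂ j) = refl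

    fromFin-injective : ∀ {i j} → fromFin i ≡ fromFin j → i ≡ j
    fromFin-injective {i} {j} eq = trans (sym (toFin-fromFin i)) (trans (cong toFin eq) (toFin-fromFin j))

  -- A half of Signed k: 0 together with exactly one of pos i, neg i for every i.
  data Agrees {k} (half : Fin k → Bool) : Signed k → Set where
    zero : Agrees half zero
    pos  : ∀ {i} → half i ≡ true → Agrees half (pos i)
    neg  : ∀ {i} → half i ≡ false → Agrees half (neg i)

  agrees-opposite⇒zero : ∀ {k} {half : Fin k → Bool} {x} → Agrees half x → Agrees half (-ˢ x) → x ≡ zero
  agrees-opposite⇒zero zero    _       = refl
  agrees-opposite⇒zero (pos p) (neg q) = contradiction (trans (sym p) q) λ ()
  agrees-opposite⇒zero (neg p) (pos q) = contradiction (trans (sym q) p) λ ()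

  opposite-values⇒equal : ∀ {A : Set} {k} {half : Fin k → Bool} (f : A → Signed k) →
                          (∀ a → Agrees half (f a)) → (∀ {a a′} → f a ≡ zero → f a′ ≡ zero → a ≡ a′) →
                          ∀ {a a′} → f a′ ≡ -ˢ f a → a ≡ a′
  opposite-values⇒equal f agrees zero-once {a} {a′} opposite = zero-once fa≡0 (trans opposite (cong -ˢ_ fa≡0))
    where
    fa≡0 : f a ≡ zero
    fa≡0 = agrees-opposite⇒zero (agrees a) (subst (Agrees _) opposite (agrees a′))

  module _ {k l : ℕ} (k≤l : k ≤ l) where

    embed : Signed k → Signed l
    embed zero    = zero
    embed (pos i) = pos (inject≤ i k≤l)
    embed (neg i) = neg (inject≤ i k≤l)

    embed-opposite : ∀ x → embed (-ˢ x) ≡ -ˢ embed x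
    embed-opposite zero    = refl
    embed-opposite (pos i) = refl
    embed-opposite (neg i) = refl

    embed-injective : ∀ {x y} → embed x ≡ embed y → x ≡ y
    embed-injective {zero}  {zero}  _  = refl
    embed-injective {pos i} {pos j} eq = cong pos (inject≤-injective k≤l k≤l i j (pos-injective eq))
    embed-injective {neg i} {neg j} eq = cong neg (inject≤-injective k≤l k≤l i j (neg-injective eq))

  nonzero⇒1≤k : ∀ {k} (s : Signed k) → s ≢ zero → 1 ≤ k
  nonzero⇒1≤k {suc _} _    _   = s≤s z≤n
  nonzero⇒1≤k {zero}  zero s≢0 = contradiction refl s≢0

  signed-one-trichotomy : ∀ {k} → k ≡ 1 → ∀ (s t : Signed k) → s ≢ zero → t ≡ zero ⊎ t ≡ s ⊎ t ≡ -ˢ s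
  signed-one-trichotomy refl s          zero       _   = inj₁ refl
  signed-one-trichotomy refl zero       _          s≢0 = contradiction refl s≢0
  signed-one-trichotomy refl (pos zero) (pos zero) _   = inj₂ (inj₁ refl)
  signed-one-trichotomy refl (pos zero) (neg zero) _   = inj₂ (inj₂ refl)
  signed-one-trichotomy refl (neg zero) (pos zero) _   = inj₂ (inj₂ refl)
  signed-one-trichotomy refl (neg zero) (neg zero) _   = inj₂ (inj₁ refl)

module InvolutionNormalForm where

  open import Data.Nat using (zero; _+_; _<_; _<?_)
  open import Data.Nat.Properties using (<-cmp; <-irrefl; <-asym; suc-injective)
  import Data.Fin.Properties as Finₚ
  open import Data.Fin.Permutation using (permutation; ↔⇒≡)
  open import Data.Product using (Σ)
  open import Relation.Binary.Definitions using (tri<; tri≈; tri>)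
  open import Relation.Nullary using (contradiction)
  open import Relation.Unary using (Decidable)
  open import Relation.Binary.PropositionalEquality using (_≡_; _≢_; refl; cong; trans; sym; subst)
  open DecidableSubsets
  open SignedSets

  record SignedForm (n : ℕ) (ν : Fin n → Fin n) : Set where
    field
      half                : ℕ
      toSigned            : Fin n → Signed half
      fromSigned          : Signed half → Fin n
      fromSigned-toSigned : ∀ x → fromSigned (toSigned x) ≡ x
      toSigned-fromSigned : ∀ s → toSigned (fromSigned s) ≡ s
      toSigned-ν          : ∀ x → toSigned (ν x) ≡ -ˢ toSigned x

    cardinality : n ≡ suc (half + half)
    cardinality = ↔⇒≡ (permutation (toFin ∘ toSigned) (fromSigned ∘ fromFin)
      (λ i → trans (cong toFin (toSigned-fromSigned (fromFin i))) (toFin-fromFin i))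
      (λ x → trans (cong fromSigned (fromFin-toFin (toSigned x))) (fromSigned-toSigned x)))

  module _ {n} (ν : Fin n → Fin n) (ν-involutive : ∀ x → ν (ν x) ≡ x)
           (z : Fin n) (ν-z : ν z ≡ z) (fixed⇒z : ∀ x → ν x ≡ x → x ≡ z) where

    private
      Positive : Fin n → Set
      Positive x = toℕ x < toℕ (ν x)

      positive? : Decidable Positive
      positive? x = toℕ x <? toℕ (ν x)

      data Sign (x : Fin n) : Set where
        origin   : x ≡ z → Sign x
        positive : Positive x → Sign x
        negative : Positive (ν x) → Sign x

      sign : ∀ x → Sign x
      sign x with <-cmp (toℕ x) (toℕ (ν x))
      ... | tri< x<νx _ _ = positive x<νx
      ... | tri≈ _ x≡νx _ = origin (fixed⇒z x (sym (Finₚ.toℕ-injective x≡νx)))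
      ... | tri> _ _ νx<x = negative (subst (λ y → toℕ (ν x) < toℕ y) (sym (ν-involutive x)) νx<x)

      half : ℕ
      half = count positive?

      signed : ∀ {x} → Sign x → Signed half
      signed     (origin _)   = zero
      signed {x} (positive p) = pos (index positive? x p)
      signed {x} (negative p) = neg (index positive? (ν x) p)

      ¬positive-z : ¬ Positive z
      ¬positive-z = <-irrefl (cong toℕ (sym ν-z))

      ¬positive-both : ∀ {x} → Positive x → ¬ Positive (ν x)
      ¬positive-both {x} p q = <-asym p (subst (λ y → toℕ (ν x) < toℕ y) (ν-involutive x) q)

      index-irrelevant : ∀ {x y} (p : Positive x) (q : Positive y) → x ≡ y → index positive? x p ≡ index positive? y q
      index-irrelevant {x} {y} p q x≡y =
        element-injective positive? (trans (element-index positive? x p) (trans x≡y (sym (element-index positive? y q))))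

      signed-irrelevant : ∀ {x} (s t : Sign x) → signed s ≡ signed t
      signed-irrelevant (origin _)    (origin _)    = refl
      signed-irrelevant (positive p)  (positive q)  = cong pos (index-irrelevant p q refl)
      signed-irrelevant (negative p)  (negative q)  = cong neg (index-irrelevant p q refl)
      signed-irrelevant (origin refl) (positive q)  = contradiction q ¬positive-z
      signed-irrelevant (origin refl) (negative q)  = contradiction (subst Positive ν-z q) ¬positive-z
      signed-irrelevant (positive p)  (origin refl) = contradiction p ¬positive-z
      signed-irrelevant (negative p)  (origin refl) = contradiction (subst Positive ν-z p) ¬positive-z
      signed-irrelevant (positive p)  (negative q)  = contradiction q (¬positive-both p)
      signed-irrelevant (negative p)  (positive q)  = contradiction p (¬positive-both q)

      toSigned : Fin n → Signed half
      toSigned x = signed (sign x)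

      fromSigned : Signed half → Fin n
      fromSigned zero    = z
      fromSigned (pos i) = element positive? i
      fromSigned (neg i) = ν (element positive? i)

      sign-ν : ∀ {x} → Sign x → Sign (ν x)
      sign-ν (origin refl)    = origin ν-z
      sign-ν {x} (positive p) = negative (subst Positive (sym (ν-involutive x)) p)
      sign-ν (negative p)     = positive p

      signed-ν : ∀ {x} (s : Sign x) → signed (sign-ν s) ≡ -ˢ signed s
      signed-ν (origin refl)    = refl
      signed-ν {x} (positive p) = cong neg (index-irrelevant _ p (ν-involutive x))
      signed-ν (negative p)     = refl

      toSigned-ν : ∀ x → toSigned (ν x) ≡ -ˢ toSigned x
      toSigned-ν x = trans (signed-irrelevant (sign (ν x)) (sign-ν (sign x))) (signed-ν (sign x))

      fromSigned-signed : ∀ {x} (s : Sign x) → fromSigned (signed s) ≡ x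
      fromSigned-signed (origin x≡z)     = sym x≡z
      fromSigned-signed {x} (positive p) = element-index positive? x p
      fromSigned-signed {x} (negative p) = trans (cong ν (element-index positive? (ν x) p)) (ν-involutive x)

      toSigned-element : ∀ i → toSigned (element positive? i) ≡ pos i
      toSigned-element i = trans (signed-irrelevant (sign _) (positive (element-satisfies positive? i)))
                                 (cong pos (index-element positive? i _))

      toSigned-fromSigned : ∀ s → toSigned (fromSigned s) ≡ s
      toSigned-fromSigned zero    = signed-irrelevant (sign z) (origin refl)
      toSigned-fromSigned (pos i) = toSigned-element i
      toSigned-fromSigned (neg i) = trans (toSigned-ν (element positive? i)) (cong -ˢ_ (toSigned-element i))

    signedForm : SignedForm n ν
    signedForm = record
      { half                = half
      ; toSigned            = toSigned
      ; fromSigned          = fromSigned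
      ; fromSigned-toSigned = λ x → fromSigned-signed (sign x)
      ; toSigned-fromSigned = toSigned-fromSigned
      ; toSigned-ν          = toSigned-ν
      }

  -- Adjoining a fixed point gives an involution with a normal form.
  fixed-point-free-involution⇒even : ∀ {n} (ν : Fin n → Fin n) → (∀ x → ν (ν x) ≡ x) → (∀ x → ν x ≢ x) →
                                     Σ ℕ λ k → n ≡ k + k
  fixed-point-free-involution⇒even {n} ν ν-involutive fixed-point-free =
    SignedForm.half form , suc-injective (SignedForm.cardinality form)
    where
    ν⁺ : Fin (suc n) → Fin (suc n)
    ν⁺ zero    = zero
    ν⁺ (suc x) = suc (ν x)

    ν⁺-involutive : ∀ x → ν⁺ (ν⁺ x) ≡ x
    ν⁺-involutive zero    = refl
    ν⁺-involutive (suc x) = cong suc (ν-involutive x)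

    fixed⇒zero : ∀ x → ν⁺ x ≡ x → x ≡ zero
    fixed⇒zero zero    _  = refl
    fixed⇒zero (suc x) eq = contradiction (Finₚ.suc-injective eq) (fixed-point-free x)

    form : SignedForm (suc n) ν⁺
    form = signedForm ν⁺ ν⁺-involutive zero refl fixed⇒zero

module SeparatingShifts where

  open import Data.Nat using (zero; _+_)
  open import Data.Fin using (fromℕ; inject₁; inject≤)
  open import Data.Fin.Properties using (_≟_; suc-injective)
  open import Data.Bool using (Bool; true; false)
  open import Data.Unit using (⊤; tt)
  open import Relation.Nullary using (yes; no; does; contradiction)
  open import Relation.Nullary.Decidable using (dec-true; dec-false)
  open import Relation.Binary.PropositionalEquality using (_≡_; _≢_; refl; cong; trans; sym; subst)
  open SignedSets

  -- i ↦ i + 1 modulo n + 1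
  rotate : ∀ {n} → Fin (suc n) → Fin (suc n)
  rotate {zero}  zero    = zero
  rotate {suc n} zero    = suc zero
  rotate {suc n} (suc i) with rotate i
  ... | zero  = zero
  ... | suc j = suc (suc j)

  rotate⁻¹ : ∀ {n} → Fin (suc n) → Fin (suc n)
  rotate⁻¹ {n} zero = fromℕ n
  rotate⁻¹ (suc i)  = inject₁ i

  rotate-fromℕ : ∀ n → rotate (fromℕ n) ≡ zero
  rotate-fromℕ zero    = refl
  rotate-fromℕ (suc n) rewrite rotate-fromℕ n = refl

  rotate-inject₁ : ∀ {n} (i : Fin (suc n)) → rotate (inject₁ i) ≡ suc i
  rotate-inject₁ zero            = refl
  rotate-inject₁ {suc n} (suc i) rewrite rotate-inject₁ i = refl

  rotate-rotate⁻¹ : ∀ {n} (i : Fin (suc n)) → rotate (rotate⁻¹ i) ≡ i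
  rotate-rotate⁻¹ {n}     zero    = rotate-fromℕ n
  rotate-rotate⁻¹ {suc n} (suc i) = rotate-inject₁ i

  rotate-fixed-point-free : ∀ {n} (i : Fin (suc (suc n))) → rotate i ≢ i
  rotate-fixed-point-free zero ()
  rotate-fixed-point-free (suc i) eq with rotate i in rotate-i
  rotate-fixed-point-free (suc i) () | zero
  rotate-fixed-point-free {zero}  (suc zero) eq | suc j with () ← rotate-i
  rotate-fixed-point-free {suc n} (suc i)    eq | suc j = rotate-fixed-point-free i (trans rotate-i (suc-injective eq))

  partner : ∀ {k} → Fin k → Fin k
  partner {suc _} = rotate

  module _ {k : ℕ} where

    Admissible : Signed k → Set
    Admissible (neg i) = partner i ≢ i
    Admissible _       = ⊤

    -- shift (pos i) swaps 0 and pos i; shift (neg i) is the cycle 0 ↦ neg i ↦ neg c ↦ pos i ↦ 0, c = partner i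
    shift : Signed k → Signed k → Signed k
    shift zero    u       = u
    shift (pos i) zero    = pos i
    shift (pos i) (pos j) with j ≟ i
    ... | yes _ = zero
    ... | no _  = pos j
    shift (pos i) (neg j) = neg j
    shift (neg i) zero    = neg i
    shift (neg i) (pos j) with j ≟ i
    ... | yes _ = zero
    ... | no _  = pos j
    shift (neg i) (neg j) with j ≟ i | j ≟ partner i
    ... | yes _ | _     = neg (partner i)
    ... | no _  | yes _ = pos i
    ... | no _  | no _  = neg j

    unshift : Signed k → Signed k → Signed k
    unshift (neg i) zero    = pos i
    unshift (neg i) (pos j) with j ≟ i
    ... | yes _ = neg (partner i)
    ... | no _  = pos j
    unshift (neg i) (neg j) with j ≟ i | j ≟ partner i
    ... | yes _ | _     = zero
    ... | no _  | yes _ = neg i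
    ... | no _  | no _  = neg j
    unshift r w = shift r w

    unshift-shift : ∀ r → Admissible r → ∀ u → unshift r (shift r u) ≡ u
    unshift-shift zero    _ u = refl
    unshift-shift (pos i) _ zero with i ≟ i
    ... | yes _  = refl
    ... | no i≢i = contradiction refl i≢i
    unshift-shift (pos i) _ (pos j) with j ≟ i
    ... | yes refl = refl
    ... | no j≢i with j ≟ i
    ...   | yes j≡i = contradiction j≡i j≢i
    ...   | no _    = refl
    unshift-shift (pos i) _ (neg j) = refl
    unshift-shift (neg i) _ zero with i ≟ i | i ≟ partner i
    ... | yes _  | _ = refl
    ... | no i≢i | _ = contradiction refl i≢i
    unshift-shift (neg i) _ (pos j) with j ≟ i
    ... | yes refl = refl
    ... | no j≢i with j ≟ i
    ...   | yes j≡i = contradiction j≡i j≢i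
    ...   | no _    = refl
    unshift-shift (neg i) c≢i (neg j) with j ≟ i | j ≟ partner i
    ... | yes refl | _ with partner j ≟ j | partner j ≟ partner j
    ...   | yes c≡i | _      = contradiction c≡i c≢i
    ...   | no _    | yes _  = refl
    ...   | no _    | no c≢c = contradiction refl c≢c
    unshift-shift (neg i) c≢i (neg j) | no j≢i | yes refl with i ≟ i
    ...   | yes _  = refl
    ...   | no i≢i = contradiction refl i≢i
    unshift-shift (neg i) c≢i (neg j) | no j≢i | no j≢c with j ≟ i | j ≟ partner i
    ...   | yes j≡i | _       = contradiction j≡i j≢i
    ...   | no _    | yes j≡c = contradiction j≡c j≢c
    ...   | no _    | no _    = refl

    shift-injective : ∀ {r} → Admissible r → ∀ {u v} → shift r u ≡ shift r v → u ≡ v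
    shift-injective {r} admissible {u} {v} eq =
      trans (sym (unshift-shift r admissible u)) (trans (cong (unshift r) eq) (unshift-shift r admissible v))

    shift-zero : ∀ r → shift r zero ≡ r
    shift-zero zero    = refl
    shift-zero (pos i) = refl
    shift-zero (neg i) = refl

    -- Whatever the row, the elements shifted to w lie in the half columnHalf w, and 0 only in row w.
    columnHalf : Signed k → Fin k → Bool
    columnHalf zero    _ = true
    columnHalf (pos j) i = does (i ≟ j)
    columnHalf (neg j) _ = false

    shift-agrees : ∀ r → Admissible r → ∀ u → Agrees (columnHalf (shift r u)) u
    shift-agrees r       _ zero    = zero
    shift-agrees zero    _ (pos j) = pos (dec-true (j ≟ j) refl)
    shift-agrees zero    _ (neg j) = neg refl
    shift-agrees (pos i) _ (pos j) with j ≟ i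
    ... | yes _ = pos refl
    ... | no _  = pos (dec-true (j ≟ j) refl)
    shift-agrees (pos i) _ (neg j) = neg refl
    shift-agrees (neg i) _ (pos j) with j ≟ i
    ... | yes _ = pos refl
    ... | no _  = pos (dec-true (j ≟ j) refl)
    shift-agrees (neg i) c≢i (neg j) with j ≟ i | j ≟ partner i
    ... | yes _ | _        = neg refl
    ... | no _  | yes refl = neg (dec-false (partner i ≟ i) c≢i)
    ... | no _  | no _     = neg refl

    shift-separates : ∀ {r s} → Admissible r → Admissible s →
                      ∀ {u v} → shift r u ≡ shift s v → v ≡ -ˢ u → r ≡ s
    shift-separates {r} {s} admissible-r admissible-s {u} {v} eq v≡-u = trans (sym w≡r) w≡s
      where
      u≡0 : u ≡ zero
      u≡0 = agrees-opposite⇒zero (shift-agrees r admissible-r u)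
              (subst (Agrees (columnHalf (shift r u))) v≡-u
                (subst (λ w → Agrees (columnHalf w) v) (sym eq) (shift-agrees s admissible-s v)))
      w≡r : shift r u ≡ r
      w≡r = trans (cong (shift r) u≡0) (shift-zero r)
      w≡s : shift r u ≡ s
      w≡s = trans eq (trans (cong (shift s) (trans v≡-u (cong -ˢ_ u≡0))) (shift-zero s))

  all-admissible : ∀ {h} (x : Signed (suc (suc h))) → Admissible x
  all-admissible zero    = tt
  all-admissible (pos _) = tt
  all-admissible (neg i) = rotate-fixed-point-free i

  row-admissible : ∀ {k m} (m≤ : m ≤ suc (k + k)) → 2 ≤ k ⊎ m ≤ 2 →
                   ∀ r → Admissible (fromFin {k} (inject≤ r m≤))
  row-admissible {suc (suc h)} m≤ (inj₁ _) r = all-admissible (fromFin {suc (suc h)} (inject≤ r m≤))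
  row-admissible {suc zero} _ (inj₁ (s≤s ())) _
  row-admissible m≤ (inj₂ _) zero = tt
  row-admissible {zero}  (s≤s ()) (inj₂ _) (suc zero)
  row-admissible {suc h} m≤ (inj₂ _) (suc zero) = tt
  row-admissible {m = suc (suc (suc _))} _ (inj₂ (s≤s (s≤s ()))) (suc (suc _))

module PairColourings where

  open import Data.Nat using (zero)
  open import Data.Fin.Properties using (_≟_)
  open import Data.Bool using (Bool; true; false; not)
  open import Data.Product using (proj₁; proj₂; uncurry)
  open import Data.Sum using ([_,_]′)
  open import Relation.Nullary using (does)
  open import Relation.Nullary.Decidable using (dec-true; dec-false)
  open import Relation.Binary.PropositionalEquality using (_≡_; refl; cong; cong₂; trans; sym)
  open SignedSets
  open SeparatingShifts

  record SignedPairColouring (k : ℕ) : Set where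
    field
      colour label : Signed k → Signed k → Signed k
      injective    : ∀ {a s b t} → colour a s ≡ colour b t → label a s ≡ label b t → a ≡ b × s ≡ t
      separates    : ∀ {a s b t} → colour a s ≡ colour b t → b ≡ -ˢ a ⊎ t ≡ -ˢ s → label a s ≡ label b t

  module Construction {m : ℕ} where

    private
      k : ℕ
      k = suc (suc m)

      one : Fin k
      one = suc zero

    -- Each colour class of 2k + 1 pairs lies in one half in either coordinate and meets 0 there only once.
    colourLabel : Signed k → Signed k → Signed k × Signed k
    colourLabel zero                s       = s , zero
    colourLabel (pos i)             zero    = pos i , pos zero
    colourLabel (pos zero)          (pos j) = zero , pos j
    colourLabel (pos (suc i))       (pos j) = pos j , pos (suc i)
    colourLabel (pos i)             (neg j) = pos (rotate⁻¹ j) , neg i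
    colourLabel (neg i)             zero    = neg i , pos one
    colourLabel (neg zero)          (pos j) = neg (rotate⁻¹ j) , pos zero
    colourLabel (neg (suc zero))    (pos j) = zero , neg j
    colourLabel (neg (suc (suc i))) (pos j) = neg (rotate⁻¹ j) , pos (suc (suc i))
    colourLabel (neg i)             (neg j) = neg j , neg i

    colourLabel⁻¹ : Signed k → Signed k → Signed k × Signed k
    colourLabel⁻¹ zero    zero                = zero , zero
    colourLabel⁻¹ zero    (pos j)             = pos zero , pos j
    colourLabel⁻¹ zero    (neg j)             = neg one , pos j
    colourLabel⁻¹ (pos c) zero                = zero , pos c
    colourLabel⁻¹ (pos c) (pos zero)          = pos c , zero
    colourLabel⁻¹ (pos c) (pos (suc i))       = pos (suc i) , pos c
    colourLabel⁻¹ (pos c) (neg i)             = pos i , neg (rotate c)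
    colourLabel⁻¹ (neg c) zero                = zero , neg c
    colourLabel⁻¹ (neg c) (pos zero)          = neg zero , pos (rotate c)
    colourLabel⁻¹ (neg c) (pos (suc zero))    = neg c , zero
    colourLabel⁻¹ (neg c) (pos (suc (suc i))) = neg (suc (suc i)) , pos (rotate c)
    colourLabel⁻¹ (neg c) (neg i)             = neg i , neg c

    colourLabel⁻¹-colourLabel : ∀ a s → uncurry colourLabel⁻¹ (colourLabel a s) ≡ (a , s)
    colourLabel⁻¹-colourLabel zero                zero    = refl
    colourLabel⁻¹-colourLabel zero                (pos j) = refl
    colourLabel⁻¹-colourLabel zero                (neg j) = refl
    colourLabel⁻¹-colourLabel (pos i)             zero    = refl
    colourLabel⁻¹-colourLabel (pos zero)          (pos j) = refl
    colourLabel⁻¹-colourLabel (pos (suc i))       (pos j) = refl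
    colourLabel⁻¹-colourLabel (pos i)             (neg j) = cong (λ c → pos i , neg c) (rotate-rotate⁻¹ j)
    colourLabel⁻¹-colourLabel (neg i)             zero    = refl
    colourLabel⁻¹-colourLabel (neg zero)          (pos j) = cong (λ c → neg zero , pos c) (rotate-rotate⁻¹ j)
    colourLabel⁻¹-colourLabel (neg (suc zero))    (pos j) = refl
    colourLabel⁻¹-colourLabel (neg (suc (suc i))) (pos j) = cong (λ c → neg (suc (suc i)) , pos c) (rotate-rotate⁻¹ j)
    colourLabel⁻¹-colourLabel (neg i)             (neg j) = refl

    firstHalf secondHalf : Signed k → Fin k → Bool
    firstHalf zero    i = not (does (i ≟ one))
    firstHalf (pos _) _ = true
    firstHalf (neg _) _ = false
    secondHalf zero    _ = true
    secondHalf (pos c) i = does (i ≟ c)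
    secondHalf (neg c) i = not (does (i ≟ c))

    first-agrees : ∀ v ℓ → Agrees (firstHalf v) (proj₁ (colourLabel⁻¹ v ℓ))
    first-agrees zero    zero                = zero
    first-agrees zero    (pos j)             = pos refl
    first-agrees zero    (neg j)             = neg refl
    first-agrees (pos c) zero                = zero
    first-agrees (pos c) (pos zero)          = pos refl
    first-agrees (pos c) (pos (suc i))       = pos refl
    first-agrees (pos c) (neg i)             = pos refl
    first-agrees (neg c) zero                = zero
    first-agrees (neg c) (pos zero)          = neg refl
    first-agrees (neg c) (pos (suc zero))    = neg refl
    first-agrees (neg c) (pos (suc (suc i))) = neg refl
    first-agrees (neg c) (neg i)             = neg refl

    second-agrees : ∀ v ℓ → Agrees (secondHalf v) (proj₂ (colourLabel⁻¹ v ℓ))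
    second-agrees zero    zero                = zero
    second-agrees zero    (pos j)             = pos refl
    second-agrees zero    (neg j)             = pos refl
    second-agrees (pos c) zero                = pos (dec-true (c ≟ c) refl)
    second-agrees (pos c) (pos zero)          = zero
    second-agrees (pos c) (pos (suc i))       = pos (dec-true (c ≟ c) refl)
    second-agrees (pos c) (neg i)             = neg (dec-false (rotate c ≟ c) (rotate-fixed-point-free c))
    second-agrees (neg c) zero                = neg (cong not (dec-true (c ≟ c) refl))
    second-agrees (neg c) (pos zero)          = pos (cong not (dec-false (rotate c ≟ c) (rotate-fixed-point-free c)))
    second-agrees (neg c) (pos (suc zero))    = zero
    second-agrees (neg c) (pos (suc (suc i))) = pos (cong not (dec-false (rotate c ≟ c) (rotate-fixed-point-free c)))
    second-agrees (neg c) (neg i)             = neg (cong not (dec-true (c ≟ c) refl))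

    secondZero : Signed k → Signed k
    secondZero zero    = zero
    secondZero (pos _) = pos zero
    secondZero (neg _) = pos one

    first-zero : ∀ v ℓ → proj₁ (colourLabel⁻¹ v ℓ) ≡ zero → ℓ ≡ zero
    first-zero zero    zero                _ = refl
    first-zero (pos c) zero                _ = refl
    first-zero (neg c) zero                _ = refl
    first-zero (pos c) (pos zero)          ()
    first-zero (pos c) (pos (suc i))       ()
    first-zero (neg c) (pos zero)          ()
    first-zero (neg c) (pos (suc zero))    ()
    first-zero (neg c) (pos (suc (suc i))) ()

    second-zero : ∀ v ℓ → proj₂ (colourLabel⁻¹ v ℓ) ≡ zero → ℓ ≡ secondZero v
    second-zero zero    zero             _ = refl
    second-zero (pos c) (pos zero)       _ = refl
    second-zero (neg c) (pos (suc zero)) _ = refl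

    colour label : Signed k → Signed k → Signed k
    colour a s = proj₁ (colourLabel a s)
    label  a s = proj₂ (colourLabel a s)

    colourLabel-injective : ∀ {a s b t} → colour a s ≡ colour b t → label a s ≡ label b t → a ≡ b × s ≡ t
    colourLabel-injective {a} {s} {b} {t} c≡ l≡ = cong proj₁ as≡bt , cong proj₂ as≡bt
      where
      as≡bt : (a , s) ≡ (b , t)
      as≡bt = trans (sym (colourLabel⁻¹-colourLabel a s))
                (trans (cong₂ colourLabel⁻¹ c≡ l≡) (colourLabel⁻¹-colourLabel b t))

    colourLabel-separates : ∀ {a s b t} → colour a s ≡ colour b t → b ≡ -ˢ a ⊎ t ≡ -ˢ s → label a s ≡ label b t
    colourLabel-separates {a} {s} {b} {t} c≡ =
      [ separated-by proj₁ (first-agrees v) (first-zero v) , separated-by proj₂ (second-agrees v) (second-zero v) ]′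
      where
      v : Signed k
      v = colour a s

      inverse-as : colourLabel⁻¹ v (label a s) ≡ (a , s)
      inverse-as = colourLabel⁻¹-colourLabel a s

      inverse-bt : colourLabel⁻¹ v (label b t) ≡ (b , t)
      inverse-bt = trans (cong (λ w → colourLabel⁻¹ w (label b t)) c≡) (colourLabel⁻¹-colourLabel b t)

      separated-by : ∀ (π : Signed k × Signed k → Signed k) {half z} →
                     (∀ ℓ → Agrees half (π (colourLabel⁻¹ v ℓ))) →
                     (∀ ℓ → π (colourLabel⁻¹ v ℓ) ≡ zero → ℓ ≡ z) →
                     π (b , t) ≡ -ˢ π (a , s) → label a s ≡ label b t
      separated-by π agrees zero-at opposite =
        opposite-values⇒equal (π ∘ colourLabel⁻¹ v) agrees
          (λ {ℓ} {ℓ′} e e′ → trans (zero-at ℓ e) (sym (zero-at ℓ′ e′)))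
          (trans (cong π inverse-bt) (trans opposite (cong (-ˢ_ ∘ π) (sym inverse-as))))

  signedPairColouring : ∀ {k} → 2 ≤ k → SignedPairColouring k
  signedPairColouring {suc (suc m)} _ = record
    { colour = colour ; label = label ; injective = colourLabel-injective ; separates = colourLabel-separates }
    where open Construction {m}
  signedPairColouring {suc zero} (s≤s ())

module SizeArithmetic where

  open import Data.Nat using (zero; _+_; s≤s⁻¹)
  open import Data.Nat.Properties using (+-suc; m≤n+m; suc-injective)
  open import Relation.Nullary using (contradiction)
  open import Relation.Binary.PropositionalEquality using (_≡_; refl; cong; trans; sym; subst; subst₂)

  k+k≤l+l⇒k≤l : ∀ {k l} → k + k ≤ l + l → k ≤ l
  k+k≤l+l⇒k≤l {zero}          _  = z≤n
  k+k≤l+l⇒k≤l {suc k} {suc l} le =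
    s≤s (k+k≤l+l⇒k≤l (s≤s⁻¹ (subst₂ _≤_ (+-suc k k) (+-suc l l) (s≤s⁻¹ le))))

  k+k≤1+l+l⇒k≤l : ∀ {k l} → k + k ≤ suc (l + l) → k ≤ l
  k+k≤1+l+l⇒k≤l {zero}          _  = z≤n
  k+k≤1+l+l⇒k≤l {suc k} {zero}  le with () ← subst (_≤ 0) (+-suc k k) (s≤s⁻¹ le)
  k+k≤1+l+l⇒k≤l {suc k} {suc l} le =
    s≤s (k+k≤1+l+l⇒k≤l (s≤s⁻¹ (subst₂ _≤_ (+-suc k k) (cong suc (+-suc l l)) (s≤s⁻¹ le))))

  k+k≡2⇒k≡1 : ∀ {k} → k + k ≡ 2 → k ≡ 1
  k+k≡2⇒k≡1 {1}           _  = refl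
  k+k≡2⇒k≡1 {suc (suc k)} eq with () ← trans (sym (+-suc k (suc k))) (suc-injective (suc-injective eq))

  5≤1+2k⇒2≤k : ∀ {k} → 5 ≤ suc (k + k) → 2 ≤ k
  5≤1+2k⇒2≤k {0}           (s≤s ())
  5≤1+2k⇒2≤k {1}           (s≤s (s≤s (s≤s ())))
  5≤1+2k⇒2≤k {suc (suc k)} _ = s≤s (s≤s z≤n)

  ¬5≤1+2k⇒k≤1 : ∀ {k} → ¬ 5 ≤ suc (k + k) → k ≤ 1
  ¬5≤1+2k⇒k≤1 {0}           _   = z≤n
  ¬5≤1+2k⇒k≤1 {1}           _   = s≤s z≤n
  ¬5≤1+2k⇒k≤1 {suc (suc k)} ¬5≤ =
    contradiction (s≤s (s≤s (s≤s (≤-trans (s≤s (s≤s z≤n)) (m≤n+m (suc (suc k)) k))))) ¬5≤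

module FieldLemmas where

  open import Data.Nat as ℕ using (zero; _<_)
  import Data.Nat.Properties as ℕₚ
  open import Data.Nat.Divisibility using (divides)
  open import Data.Fin.Properties using (_≟_)
  open import Data.Product using (Σ; proj₁; proj₂)
  open import Function.Bundles using (Bijection; Surjection)
  open import Relation.Nullary using (Dec; yes; no; contradiction)
  open import Relation.Binary.PropositionalEquality as ≡ using (_≡_; _≢_)
  open SignedSets
  open InvolutionNormalForm
  open SizeArithmetic

  module FieldProperties {c ℓ : Level} (F : Field c ℓ) where
    open Field F
    open import Relation.Binary.Reasoning.Setoid setoid
    open import Algebra.Properties.Group +-group public
      using (inverseʳ-unique; ⁻¹-involutive; ε⁻¹≈ε; ∙-cancelˡ; ∙-cancelʳ)
    open import Algebra.Properties.AbelianGroup +-abelianGroup public using (⁻¹-∙-comm)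
    open import Algebra.Properties.Ring ring public using (-1*x≈-x)

    two : Carrier
    two = 1# + 1#

    x+x≈two*x : ∀ x → x + x ≈ two * x
    x+x≈two*x x = begin
      x + x           ≈⟨ +-cong (*-identityˡ x) (*-identityˡ x) ⟨
      1# * x + 1# * x ≈⟨ distribʳ x 1# 1# ⟨
      two * x         ∎

    x*y≈0⇒x≈0 : ∀ {x y} → x * y ≈ 0# → ¬ (y ≈ 0#) → x ≈ 0#
    x*y≈0⇒x≈0 {x} {y} xy≈0 y≉0 with inverse y y≉0
    ... | y⁻¹ , yy⁻¹≈1 = begin
      x              ≈⟨ *-identityʳ x ⟨
      x * 1#         ≈⟨ *-congˡ yy⁻¹≈1 ⟨
      x * (y * y⁻¹)  ≈⟨ *-assoc x y y⁻¹ ⟨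
      (x * y) * y⁻¹  ≈⟨ *-congʳ xy≈0 ⟩
      0# * y⁻¹       ≈⟨ zeroˡ y⁻¹ ⟩
      0#             ∎

    x+y≈0⇒y≈-x : ∀ {x y} → x + y ≈ 0# → y ≈ - x
    x+y≈0⇒y≈-x {x} {y} = inverseʳ-unique x y

    natTimes1-+ : ∀ a b → natTimes1 F (a ℕ.+ b) ≈ natTimes1 F a + natTimes1 F b
    natTimes1-+ zero    b = sym (+-identityˡ _)
    natTimes1-+ (suc a) b = trans (+-congˡ (natTimes1-+ a b)) (sym (+-assoc 1# _ _))

    even⇒two≈0 : EvenCharacteristic F → two ≈ 0#
    even⇒two≈0 (_ , (() , _ , _) , divides zero ≡.refl)
    even⇒two≈0 (_ , (_ , p·1≈0 , minimal) , divides (suc h) ≡.refl) =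
      x*y≈0⇒x≈0 two·h≈0
        (minimal (suc h) (s≤s z≤n) (≡.subst (suc h <_) h+h≡h*2 (ℕₚ.m<m+n (suc h) (s≤s z≤n))))
      where
      h+h≡h*2 : suc h ℕ.+ suc h ≡ suc h ℕ.* 2
      h+h≡h*2 = ≡.trans (≡.cong (suc h ℕ.+_) (≡.sym (ℕₚ.+-identityʳ (suc h)))) (ℕₚ.*-comm 2 (suc h))

      two·h≈0 : two * natTimes1 F (suc h) ≈ 0#
      two·h≈0 = begin
        two * natTimes1 F (suc h)                  ≈⟨ x+x≈two*x _ ⟨
        natTimes1 F (suc h) + natTimes1 F (suc h)  ≈⟨ natTimes1-+ (suc h) (suc h) ⟨
        natTimes1 F (suc h ℕ.+ suc h)              ≡⟨ ≡.cong (natTimes1 F) h+h≡h*2 ⟩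
        natTimes1 F (suc h ℕ.* 2)                  ≈⟨ p·1≈0 ⟩
        0#                                         ∎

    odd⇒two≉0 : OddCharacteristic F → ¬ (two ≈ 0#)
    odd⇒two≉0 (zero , (() , _) , _)
    odd⇒two≉0 (1 , (_ , 1+0≈0 , _) , _) _ = 1≉0 (trans (sym (+-identityʳ 1#)) 1+0≈0)
    odd⇒two≉0 (2 , _ , 2∤2) _ = 2∤2 (divides 1 ≡.refl)
    odd⇒two≉0 (suc (suc (suc p)) , (_ , _ , minimal) , _) two≈0 =
      minimal 2 (s≤s z≤n) (s≤s (s≤s (s≤s z≤n))) (trans (+-congˡ (+-identityʳ 1#)) two≈0)

    two≈0⇒x≈-x : two ≈ 0# → ∀ x → x ≈ - x
    two≈0⇒x≈-x two≈0 x = x+y≈0⇒y≈-x (trans (x+x≈two*x x) (trans (*-congʳ two≈0) (zeroˡ x)))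

    -x≈x⇒x≈0 : ¬ (two ≈ 0#) → ∀ {x} → - x ≈ x → x ≈ 0#
    -x≈x⇒x≈0 two≉0 {x} -x≈x =
      x*y≈0⇒x≈0 (trans (*-comm x two) (trans (sym (x+x≈two*x x)) (trans (+-congˡ (sym -x≈x)) (-‿inverseʳ x)))) two≉0

  module FiniteFieldProperties {c ℓ : Level} (F : FiniteField c ℓ) where
    open FiniteField F public hiding (zero)
    open FieldProperties field' public
    open import Relation.Binary.Reasoning.Setoid setoid

    code : Carrier → Fin size
    code = Bijection.to enumerate

    decode : Fin size → Carrier
    decode = Bijection.to⁻ enumerate

    code-cong : ∀ {x y} → x ≈ y → code x ≡ code y
    code-cong = Bijection.cong enumerate

    code-injective : ∀ {x y} → code x ≡ code y → x ≈ y
    code-injective = Bijection.injective enumerate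

    code-decode : ∀ i → code (decode i) ≡ i
    code-decode = Surjection.to∘to⁻ (Bijection.surjection enumerate)

    decode-code : ∀ x → decode (code x) ≈ x
    decode-code x = code-injective (code-decode (code x))

    decode-injective : ∀ {i j} → decode i ≈ decode j → i ≡ j
    decode-injective {i} {j} eq = ≡.trans (≡.sym (code-decode i)) (≡.trans (code-cong eq) (code-decode j))

    _≈?_ : ∀ x y → Dec (x ≈ y)
    x ≈? y with code x ≟ code y
    ... | yes eq = yes (code-injective eq)
    ... | no neq = no λ eq → neq (code-cong eq)

    ν : Fin size → Fin size
    ν i = code (- decode i)

    ν-code : ∀ x → ν (code x) ≡ code (- x)
    ν-code x = code-cong (-‿cong (decode-code x))

    ν-involutive : ∀ i → ν (ν i) ≡ i
    ν-involutive i = ≡.trans (code-cong (trans (-‿cong (decode-code _)) (⁻¹-involutive _))) (code-decode i)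

    ν-code0 : ν (code 0#) ≡ code 0#
    ν-code0 = ≡.trans (ν-code 0#) (code-cong ε⁻¹≈ε)

    signedFormOfNegation : ¬ (two ≈ 0#) → SignedForm size ν
    signedFormOfNegation two≉0 = signedForm ν ν-involutive (code 0#) ν-code0 fixed⇒code0
      where
      fixed⇒code0 : ∀ i → ν i ≡ i → i ≡ code 0#
      fixed⇒code0 i νi≡i = ≡.trans (≡.sym (code-decode i))
        (code-cong (-x≈x⇒x≈0 two≉0 (code-injective (≡.trans νi≡i (≡.sym (code-decode i))))))

    two≈0⇒size-even : two ≈ 0# → Σ ℕ λ k → size ≡ k ℕ.+ k
    two≈0⇒size-even two≈0 = fixed-point-free-involution⇒even successor successor-involutive successor-no-fixed
      where
      successor : Fin size → Fin size
      successor i = code (decode i + 1#)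

      successor-involutive : ∀ i → successor (successor i) ≡ i
      successor-involutive i = ≡.trans (code-cong (begin
        decode (code (decode i + 1#)) + 1#  ≈⟨ +-congʳ (decode-code _) ⟩
        (decode i + 1#) + 1#               ≈⟨ +-assoc _ 1# 1# ⟩
        decode i + two                     ≈⟨ +-congˡ two≈0 ⟩
        decode i + 0#                      ≈⟨ +-identityʳ _ ⟩
        decode i                           ∎)) (code-decode i)

      successor-no-fixed : ∀ i → successor i ≢ i
      successor-no-fixed i eq = 1≉0 (∙-cancelˡ (decode i) 1# 0#
        (trans (code-injective (≡.trans eq (≡.sym (code-decode i)))) (sym (+-identityʳ _))))

    module Odd (two≉0 : ¬ (two ≈ 0#)) where
      open SignedForm (signedFormOfNegation two≉0) public

      sign : Carrier → Signed half
      sign x = toSigned (code x)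

      sign-cong : ∀ {x y} → x ≈ y → sign x ≡ sign y
      sign-cong x≈y = ≡.cong toSigned (code-cong x≈y)

      fromSigned-injective : ∀ {s t} → fromSigned s ≡ fromSigned t → s ≡ t
      fromSigned-injective {s} {t} eq =
        ≡.trans (≡.sym (toSigned-fromSigned s)) (≡.trans (≡.cong toSigned eq) (toSigned-fromSigned t))

      sign-injective : ∀ {x y} → sign x ≡ sign y → x ≈ y
      sign-injective {x} {y} eq = code-injective
        (≡.trans (≡.sym (fromSigned-toSigned (code x))) (≡.trans (≡.cong fromSigned eq) (fromSigned-toSigned (code y))))

      sign-opposite : ∀ {x y} → x + y ≈ 0# → sign y ≡ -ˢ sign x
      sign-opposite {x} {y} x+y≈0 =
        ≡.trans (≡.cong toSigned (≡.trans (code-cong (x+y≈0⇒y≈-x x+y≈0)) (≡.sym (ν-code x)))) (toSigned-ν (code x))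

      sign-zero : sign 0# ≡ zero
      sign-zero = -ˢ-fixed⇒zero (≡.sym (sign-opposite (+-identityʳ 0#)))

      sign-one≢zero : sign 1# ≢ zero
      sign-one≢zero eq = 1≉0 (sign-injective (≡.trans eq (≡.sym sign-zero)))

      half≥1 : 1 ≤ half
      half≥1 = nonzero⇒1≤k (sign 1#) sign-one≢zero

      module ThreeElements (size≡3 : size ≡ 3) where

        half≡1 : half ≡ 1
        half≡1 = k+k≡2⇒k≡1 (ℕₚ.suc-injective (≡.trans (≡.sym cardinality) size≡3))

        fromℤ₃ : Fin 3 → Carrier
        fromℤ₃ zero             = 0#
        fromℤ₃ (suc zero)       = 1#
        fromℤ₃ (suc (suc zero)) = - 1#

        classify : ∀ x → Σ (Fin 3) λ i → x ≈ fromℤ₃ i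
        classify x with signed-one-trichotomy half≡1 (sign 1#) (sign x) sign-one≢zero
        ... | inj₁ x↦0         = zero , sign-injective (≡.trans x↦0 (≡.sym sign-zero))
        ... | inj₂ (inj₁ x↦1)  = suc zero , sign-injective x↦1
        ... | inj₂ (inj₂ x↦-1) =
          suc (suc zero) , sign-injective (≡.trans x↦-1 (≡.sym (sign-opposite (-‿inverseʳ 1#))))

        two≈-1 : two ≈ - 1#
        two≈-1 with classify two
        ... | zero           , two≈0  = contradiction two≈0 two≉0
        ... | suc zero       , two≈1  = contradiction (∙-cancelˡ 1# 1# 0# (trans two≈1 (sym (+-identityʳ 1#)))) 1≉0
        ... | suc (suc zero) , two≈-1 = two≈-1

        -1≉0 : ¬ (- 1# ≈ 0#)
        -1≉0 -1≈0 = 1≉0 (trans (sym (⁻¹-involutive 1#)) (trans (-‿cong -1≈0) ε⁻¹≈ε))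

        1≉-1 : ¬ (1# ≈ - 1#)
        1≉-1 1≈-1 = two≉0 (trans (+-congˡ 1≈-1) (-‿inverseʳ 1#))

        fromℤ₃-injective : ∀ {i j} → fromℤ₃ i ≈ fromℤ₃ j → i ≡ j
        fromℤ₃-injective {zero}           {zero}           _ = ≡.refl
        fromℤ₃-injective {zero}           {suc zero}       e = contradiction (sym e) 1≉0
        fromℤ₃-injective {zero}           {suc (suc zero)} e = contradiction (sym e) -1≉0
        fromℤ₃-injective {suc zero}       {zero}           e = contradiction e 1≉0
        fromℤ₃-injective {suc zero}       {suc zero}       _ = ≡.refl
        fromℤ₃-injective {suc zero}       {suc (suc zero)} e = contradiction e 1≉-1
        fromℤ₃-injective {suc (suc zero)} {zero}           e = contradiction e -1≉0
        fromℤ₃-injective {suc (suc zero)} {suc zero}       e = contradiction (sym e) 1≉-1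
        fromℤ₃-injective {suc (suc zero)} {suc (suc zero)} _ = ≡.refl

        fromℤ₃-+ : ∀ i j → fromℤ₃ i + fromℤ₃ j ≈ fromℤ₃ (i +₃ j)
        fromℤ₃-+ zero             zero             = +-identityˡ 0#
        fromℤ₃-+ zero             (suc zero)       = +-identityˡ 1#
        fromℤ₃-+ zero             (suc (suc zero)) = +-identityˡ (- 1#)
        fromℤ₃-+ (suc zero)       zero             = +-identityʳ 1#
        fromℤ₃-+ (suc zero)       (suc zero)       = two≈-1
        fromℤ₃-+ (suc zero)       (suc (suc zero)) = -‿inverseʳ 1#
        fromℤ₃-+ (suc (suc zero)) zero             = +-identityʳ (- 1#)
        fromℤ₃-+ (suc (suc zero)) (suc zero)       = -‿inverseˡ 1#
        fromℤ₃-+ (suc (suc zero)) (suc (suc zero)) =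
          trans (⁻¹-∙-comm 1# 1#) (trans (-‿cong two≈-1) (⁻¹-involutive 1#))

        fromℤ₃-* : ∀ i j → fromℤ₃ i * fromℤ₃ j ≈ fromℤ₃ (i *₃ j)
        fromℤ₃-* zero             zero             = zeroˡ 0#
        fromℤ₃-* zero             (suc zero)       = zeroˡ 1#
        fromℤ₃-* zero             (suc (suc zero)) = zeroˡ (- 1#)
        fromℤ₃-* (suc zero)       zero             = zeroʳ 1#
        fromℤ₃-* (suc zero)       (suc zero)       = *-identityˡ 1#
        fromℤ₃-* (suc zero)       (suc (suc zero)) = *-identityˡ (- 1#)
        fromℤ₃-* (suc (suc zero)) zero             = zeroʳ (- 1#)
        fromℤ₃-* (suc (suc zero)) (suc zero)       = *-identityʳ (- 1#)
        fromℤ₃-* (suc (suc zero)) (suc (suc zero)) = trans (-1*x≈-x (- 1#)) (⁻¹-involutive 1#)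

        toℤ₃ : Carrier → Fin 3
        toℤ₃ x = proj₁ (classify x)

        fromℤ₃-toℤ₃ : ∀ x → x ≈ fromℤ₃ (toℤ₃ x)
        fromℤ₃-toℤ₃ x = proj₂ (classify x)

        toℤ₃-unique : ∀ {x i} → x ≈ fromℤ₃ i → toℤ₃ x ≡ i
        toℤ₃-unique {x} x≈i = fromℤ₃-injective (trans (sym (fromℤ₃-toℤ₃ x)) x≈i)

        toℤ₃-cong : ∀ {x y} → x ≈ y → toℤ₃ x ≡ toℤ₃ y
        toℤ₃-cong {y = y} x≈y = toℤ₃-unique (trans x≈y (fromℤ₃-toℤ₃ y))

        toℤ₃-injective : ∀ {x y} → toℤ₃ x ≡ toℤ₃ y → x ≈ y
        toℤ₃-injective {x} {y} eq =
          trans (fromℤ₃-toℤ₃ x) (trans (reflexive (≡.cong fromℤ₃ eq)) (sym (fromℤ₃-toℤ₃ y)))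

        toℤ₃-+ : ∀ x y → toℤ₃ (x + y) ≡ toℤ₃ x +₃ toℤ₃ y
        toℤ₃-+ x y =
          toℤ₃-unique (trans (+-cong (fromℤ₃-toℤ₃ x) (fromℤ₃-toℤ₃ y)) (fromℤ₃-+ (toℤ₃ x) (toℤ₃ y)))

        toℤ₃-* : ∀ x y → toℤ₃ (x * y) ≡ toℤ₃ x *₃ toℤ₃ y
        toℤ₃-* x y =
          toℤ₃-unique (trans (*-cong (fromℤ₃-toℤ₃ x) (fromℤ₃-toℤ₃ y)) (fromℤ₃-* (toℤ₃ x) (toℤ₃ y)))

  CharacteristicTwo : ∀ {c ℓ} → FiniteField c ℓ → Set ℓ
  CharacteristicTwo F = two ≈ 0#
    where open FiniteFieldProperties F

module FieldColourings where

  open import Data.Nat as ℕ using (s≤s⁻¹; _≤?_)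
  import Data.Nat.Properties as ℕₚ
  open import Data.Fin using (inject≤)
  open import Data.Fin.Properties using (inject≤-injective)
  open import Data.Product using (proj₁; proj₂)
  import Data.Product as Prod
  import Data.Sum as Sum
  open import Function using (id)
  open import Relation.Nullary using (yes; no; contradiction)
  open import Relation.Binary.PropositionalEquality as ≡ using (_≡_)
  open SignedSets
  open InvolutionNormalForm
  open SeparatingShifts
  open PairColourings
  open SizeArithmetic
  open FieldLemmas

  SeparableRows : ∀ {c ℓ} → FiniteField c ℓ → ℕ → Set ℓ
  SeparableRows F m = CharacteristicTwo F ⊎ 5 ≤ ∣ F ∣ ⊎ m ≤ 2

  record RowColourings {c ℓ : Level} (F : FiniteField c ℓ) (m : ℕ) : Set (c Level.⊔ ℓ) where
    open FiniteField F hiding (zero)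
    field
      colour           : Fin m → Carrier → Fin size
      colour-cong      : ∀ r {x y} → x ≈ y → colour r x ≡ colour r y
      colour-injective : ∀ r {x y} → colour r x ≡ colour r y → x ≈ y
      colour-separates : ∀ {r s x y} → colour r x ≡ colour s y → x + y ≈ 0# → r ≡ s

  module _ {c ℓ : Level} (F : FiniteField c ℓ) where
    open FiniteFieldProperties F

    translationColourings : ∀ {m} → CharacteristicTwo F → m ≤ ∣ F ∣ → RowColourings F m
    translationColourings {m} two≈0 m≤ = record
      { colour           = colour
      ; colour-cong      = λ r x≈y → code-cong (+-congʳ x≈y)
      ; colour-injective = λ r eq → ∙-cancelʳ _ _ _ (code-injective eq)
      ; colour-separates = separates
      }
      where
      translation : Fin m → Carrier
      translation r = decode (inject≤ r m≤)

      colour : Fin m → Carrier → Fin size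
      colour r x = code (x + translation r)

      separates : ∀ {r s x y} → colour r x ≡ colour s y → x + y ≈ 0# → r ≡ s
      separates {r} {s} {x} {y} eq x+y≈0 = inject≤-injective m≤ m≤ r s (decode-injective (∙-cancelˡ x _ _
        (trans (code-injective eq) (+-congʳ (trans (x+y≈0⇒y≈-x x+y≈0) (sym (two≈0⇒x≈-x two≈0 x)))))))

    signedColourings : ∀ {m} → ¬ CharacteristicTwo F → m ≤ ∣ F ∣ → 5 ≤ ∣ F ∣ ⊎ m ≤ 2 →
                       RowColourings F m
    signedColourings {m} two≉0 m≤ large = record
      { colour           = colour
      ; colour-cong      = λ r x≈y → ≡.cong (fromSigned ∘ shift (row r)) (sign-cong x≈y)
      ; colour-injective = λ r eq → sign-injective (shift-injective (admissible r) (fromSigned-injective eq))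
      ; colour-separates = λ {r} {s} eq x+y≈0 →
          row-injective (shift-separates (admissible r) (admissible s) (fromSigned-injective eq) (sign-opposite x+y≈0))
      }
      where
      open Odd two≉0

      m≤2k+1 : m ≤ suc (half ℕ.+ half)
      m≤2k+1 = ≡.subst (m ≤_) cardinality m≤

      row : Fin m → Signed half
      row r = fromFin (inject≤ r m≤2k+1)

      row-injective : ∀ {r s} → row r ≡ row s → r ≡ s
      row-injective {r} {s} eq = inject≤-injective m≤2k+1 m≤2k+1 r s (fromFin-injective eq)

      admissible : ∀ r → Admissible (row r)
      admissible = row-admissible m≤2k+1 (Sum.map₁ (5≤1+2k⇒2≤k ∘ ≡.subst (5 ≤_) cardinality) large)

      colour : Fin m → Carrier → Fin size
      colour r x = fromSigned (shift (row r) (sign x))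

    rowColourings : ∀ {m} → m ≤ ∣ F ∣ → SeparableRows F m → RowColourings F m
    rowColourings m≤ separable with two ≈? 0#
    ... | yes two≈0 = translationColourings two≈0 m≤
    ... | no two≉0  = signedColourings two≉0 m≤ (Sum.[ (λ two≈0 → contradiction two≈0 two≉0) , id ]′ separable)

  record PairColouring {c ℓ : Level} (F G : FiniteField c ℓ) (L : ℕ) : Set (c Level.⊔ ℓ) where
    private
      module F = FiniteField F
      module G = FiniteField G
    field
      colour      : F.Carrier → G.Carrier → Fin G.size
      label       : F.Carrier → G.Carrier → Fin L
      colour-cong : ∀ {x x′ y y′} → x F.≈ x′ → y G.≈ y′ → colour x y ≡ colour x′ y′
      label-cong  : ∀ {x x′ y y′} → x F.≈ x′ → y G.≈ y′ → label x y ≡ label x′ y′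
      injective   : ∀ {x x′ y y′} → colour x y ≡ colour x′ y′ → label x y ≡ label x′ y′ →
                    x F.≈ x′ × y G.≈ y′
      separates   : ∀ {x x′ y y′} → colour x y ≡ colour x′ y′ → x F.+ x′ F.≈ F.0# ⊎ y G.+ y′ G.≈ G.0# →
                    label x y ≡ label x′ y′

  module _ {c ℓ : Level} (F G : FiniteField c ℓ) where
    private
      module F = FiniteFieldProperties F
      module G = FiniteFieldProperties G

    evenPairColouring : CharacteristicTwo F → RowColourings G ∣ F ∣ → PairColouring F G ∣ F ∣
    evenPairColouring two≈0 rows = record
      { colour      = λ x y → R.colour (F.code x) y
      ; label       = λ x _ → F.code x
      ; colour-cong = λ x≈x′ y≈y′ →
                        ≡.trans (≡.cong (λ r → R.colour r _) (F.code-cong x≈x′)) (R.colour-cong _ y≈y′)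
      ; label-cong  = λ x≈x′ _ → F.code-cong x≈x′
      ; injective   = λ c≡ l≡ → F.code-injective l≡ ,
                                R.colour-injective _ (≡.trans c≡ (≡.cong (λ r → R.colour r _) (≡.sym l≡)))
      ; separates   = λ { _  (inj₁ x+x′≈0) →
                            F.code-cong (F.trans (F.two≈0⇒x≈-x two≈0 _) (F.sym (F.x+y≈0⇒y≈-x x+x′≈0)))
                        ; c≡ (inj₂ y+y′≈0) → R.colour-separates c≡ y+y′≈0 }
      }
      where module R = RowColourings rows

    oddPairColouring : ¬ CharacteristicTwo F → ¬ CharacteristicTwo G → ∣ F ∣ ≤ ∣ G ∣ → 5 ≤ ∣ G ∣ →
                       PairColouring F G ∣ G ∣
    oddPairColouring two≉0 two≉0′ |F|≤|G| 5≤|G| = record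
      { colour      = λ x y → SG.fromSigned (P.colour (signF x) (SG.sign y))
      ; label       = λ x y → SG.fromSigned (P.label (signF x) (SG.sign y))
      ; colour-cong = λ x≈x′ y≈y′ →
                        ≡.cong SG.fromSigned (≡.cong₂ P.colour (signF-cong x≈x′) (SG.sign-cong y≈y′))
      ; label-cong  = λ x≈x′ y≈y′ →
                        ≡.cong SG.fromSigned (≡.cong₂ P.label (signF-cong x≈x′) (SG.sign-cong y≈y′))
      ; injective   = λ c≡ l≡ → Prod.map (SF.sign-injective ∘ embed-injective kF≤kG) SG.sign-injective
                                  (P.injective (SG.fromSigned-injective c≡) (SG.fromSigned-injective l≡))
      ; separates   = λ c≡ opposite → ≡.cong SG.fromSigned
                        (P.separates (SG.fromSigned-injective c≡) (Sum.map signF-opposite SG.sign-opposite opposite))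
      }
      where
      module SF = F.Odd two≉0
      module SG = G.Odd two≉0′

      kF≤kG : SF.half ≤ SG.half
      kF≤kG = k+k≤l+l⇒k≤l (s≤s⁻¹ (≡.subst₂ _≤_ SF.cardinality SG.cardinality |F|≤|G|))

      P : SignedPairColouring SG.half
      P = signedPairColouring (5≤1+2k⇒2≤k (≡.subst (5 ≤_) SG.cardinality 5≤|G|))
      module P = SignedPairColouring P

      signF : F.Carrier → Signed SG.half
      signF x = embed kF≤kG (SF.sign x)

      signF-cong : ∀ {x x′} → x F.≈ x′ → signF x ≡ signF x′
      signF-cong x≈x′ = ≡.cong (embed kF≤kG) (SF.sign-cong x≈x′)

      signF-opposite : ∀ {x x′} → x F.+ x′ F.≈ F.0# → signF x′ ≡ -ˢ signF x
      signF-opposite {x} x+x′≈0 =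
        ≡.trans (≡.cong (embed kF≤kG) (SF.sign-opposite x+x′≈0)) (embed-opposite kF≤kG (SF.sign x))

    threeElementFields≅ℤ₃×ℤ₃ : ¬ CharacteristicTwo F → ¬ CharacteristicTwo G → ∣ F ∣ ≡ 3 → ∣ G ∣ ≡ 3 →
                                (F , G) ≅Z3×Z3
    threeElementFields≅ℤ₃×ℤ₃ two≉0 two≉0′ |F|≡3 |G|≡3 = record
      { φ            = λ (a , b) → TF.toℤ₃ a , TG.toℤ₃ b
      ; φ-cong       = λ { {_ , _} {_ , _} (a≈a′ , b≈b′) → ≡.cong₂ _,_ (TF.toℤ₃-cong a≈a′) (TG.toℤ₃-cong b≈b′) }
      ; φ-injective  = λ { {_ , _} {_ , _} eq →
                           TF.toℤ₃-injective (≡.cong proj₁ eq) , TG.toℤ₃-injective (≡.cong proj₂ eq) }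
      ; φ-surjective = λ (i , j) →
                         (TF.fromℤ₃ i , TG.fromℤ₃ j) , ≡.cong₂ _,_ (TF.toℤ₃-unique F.refl) (TG.toℤ₃-unique G.refl)
      ; φ-+          = λ a b a′ b′ → ≡.cong₂ _,_ (TF.toℤ₃-+ a a′) (TG.toℤ₃-+ b b′)
      ; φ-*          = λ a b a′ b′ → ≡.cong₂ _,_ (TF.toℤ₃-* a a′) (TG.toℤ₃-* b b′)
      ; φ-0          = ≡.cong₂ _,_ (TF.toℤ₃-unique F.refl) (TG.toℤ₃-unique G.refl)
      ; φ-1          = ≡.cong₂ _,_ (TF.toℤ₃-unique F.refl) (TG.toℤ₃-unique G.refl)
      }
      where
      module TF = F.Odd.ThreeElements two≉0 |F|≡3
      module TG = G.Odd.ThreeElements two≉0′ |G|≡3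

    -- |F| is even and |G| odd, so |F| ≤ |G| < 5 forces |F| = 2.
    even⇒separableRows : CharacteristicTwo F → ∣ F ∣ ≤ ∣ G ∣ → SeparableRows G ∣ F ∣
    even⇒separableRows two≈0 |F|≤|G| with G.two G.≈? G.0# | 5 ≤? ∣ G ∣
    ... | yes two≈0′ | _      = inj₁ two≈0′
    ... | no _       | yes 5≤ = inj₂ (inj₁ 5≤)
    ... | no two≉0′  | no ¬5≤ = inj₂ (inj₂ (≡.subst (_≤ 2) (≡.sym |F|≡a+a) (ℕₚ.+-mono-≤ a≤1 a≤1)))
      where
      module SG = G.Odd two≉0′

      a : ℕ
      a = proj₁ (F.two≈0⇒size-even two≈0)

      |F|≡a+a : ∣ F ∣ ≡ a ℕ.+ a
      |F|≡a+a = proj₂ (F.two≈0⇒size-even two≈0)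

      a≤1 : a ≤ 1
      a≤1 = ℕₚ.≤-trans (k+k≤1+l+l⇒k≤l {l = SG.half} (≡.subst₂ _≤_ |F|≡a+a SG.cardinality |F|≤|G|))
                       (¬5≤1+2k⇒k≤1 (¬5≤ ∘ ≡.subst (5 ≤_) (≡.sym SG.cardinality)))

    ¬≅ℤ₃×ℤ₃⇒5≤∣G∣ : ¬ CharacteristicTwo F → ¬ CharacteristicTwo G → ∣ F ∣ ≤ ∣ G ∣ →
                    ¬ (F , G) ≅Z3×Z3 → 5 ≤ ∣ G ∣
    ¬≅ℤ₃×ℤ₃⇒5≤∣G∣ two≉0 two≉0′ |F|≤|G| ¬≅ with 5 ≤? ∣ G ∣
    ... | yes 5≤ = 5≤
    ... | no ¬5≤ = contradiction (threeElementFields≅ℤ₃×ℤ₃ two≉0 two≉0′ |F|≡3 |G|≡3) ¬≅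
      where
      module SF = F.Odd two≉0
      module SG = G.Odd two≉0′

      kG≤1 : SG.half ≤ 1
      kG≤1 = ¬5≤1+2k⇒k≤1 (¬5≤ ∘ ≡.subst (5 ≤_) (≡.sym SG.cardinality))

      kF≤kG : SF.half ≤ SG.half
      kF≤kG = k+k≤l+l⇒k≤l {SF.half} {SG.half} (s≤s⁻¹ (≡.subst₂ _≤_ SF.cardinality SG.cardinality |F|≤|G|))

      kF≡1 : SF.half ≡ 1
      kF≡1 = ℕₚ.≤-antisym (ℕₚ.≤-trans kF≤kG kG≤1) SF.half≥1

      kG≡1 : SG.half ≡ 1
      kG≡1 = ℕₚ.≤-antisym kG≤1 (ℕₚ.≤-trans SF.half≥1 kF≤kG)

      |F|≡3 : ∣ F ∣ ≡ 3
      |F|≡3 = ≡.trans SF.cardinality (≡.cong (λ k → suc (k ℕ.+ k)) kF≡1)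

      |G|≡3 : ∣ G ∣ ≡ 3
      |G|≡3 = ≡.trans SG.cardinality (≡.cong (λ k → suc (k ℕ.+ k)) kG≡1)

module TupleCode where

  open import Data.Nat using (zero)
  open import Data.Fin using (combine; remQuot)
  open import Data.Fin.Properties using (combine-remQuot; combine-injective)
  open import Data.List using (tabulate)
  open import Data.Product using (proj₁; proj₂)
  open import Relation.Binary.PropositionalEquality using (_≡_; refl; cong; cong₂; trans)

  ∏ : ∀ {p} → (Fin p → ℕ) → ℕ
  ∏ G = product (tabulate G)

  encode : ∀ {p} (G : Fin p → ℕ) → ((j : Fin p) → Fin (G j)) → Fin (∏ G)
  encode {zero}  G t = zero
  encode {suc p} G t = combine (t zero) (encode (G ∘ suc) (t ∘ suc))

  decode : ∀ {p} (G : Fin p → ℕ) → Fin (∏ G) → (j : Fin p) → Fin (G j)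
  decode {suc p} G c zero    = proj₁ (remQuot {G zero} (∏ (G ∘ suc)) c)
  decode {suc p} G c (suc j) = decode (G ∘ suc) (proj₂ (remQuot {G zero} (∏ (G ∘ suc)) c)) j

  encode-decode : ∀ {p} (G : Fin p → ℕ) c → encode G (decode G c) ≡ c
  encode-decode {zero}  G zero = refl
  encode-decode {suc p} G c    =
    trans (cong (combine {G zero} _) (encode-decode (G ∘ suc) _)) (combine-remQuot {G zero} (∏ (G ∘ suc)) c)

  encode-cong : ∀ {p} (G : Fin p → ℕ) {t t′} → (∀ j → t j ≡ t′ j) → encode G t ≡ encode G t′
  encode-cong {zero}  G eq = refl
  encode-cong {suc p} G eq = cong₂ (combine {G zero}) (eq zero) (encode-cong (G ∘ suc) (eq ∘ suc))

  encode-injective : ∀ {p} (G : Fin p → ℕ) {t t′} → encode G t ≡ encode G t′ → ∀ j → t j ≡ t′ j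
  encode-injective {suc p} G {t} {t′} eq zero    = proj₁ (combine-injective (t zero) _ (t′ zero) _ eq)
  encode-injective {suc p} G {t} {t′} eq (suc j) =
    encode-injective (G ∘ suc) (proj₂ (combine-injective (t zero) _ (t′ zero) _ eq)) j

module ProductColouring {c ℓ : Level} {n′ : ℕ} (F : Fin (suc (suc n′)) → FiniteField c ℓ) where

  open import Data.Nat using (_<_)
  open import Data.Fin.Properties using (¬∀⟶∃¬; pigeonhole; _≟_; <-irrefl)
  open import Data.List.Properties using (map-tabulate)
  open import Data.Product using (Σ; proj₁; proj₂)
  open import Relation.Nullary using (yes; no)
  open import Relation.Binary.PropositionalEquality using (_≡_; _≢_; cong; trans; sym; subst)
  open TupleCode
  open FieldLemmas
  open FieldColourings
  open Product F

  private
    module Fᵢ (i : Fin (suc (suc n′))) = FiniteFieldProperties (F i)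

  tailSize : Fin (suc n′) → ℕ
  tailSize j = ∣ F (suc j) ∣

  zeroDivisor⇒zeroCoordinate : ∀ {z} → ZeroDivisor z → Σ (Fin (suc (suc n′))) λ i → Fᵢ._≈_ i (z i) (Fᵢ.0# i)
  zeroDivisor⇒zeroCoordinate {z} (y , y≉0 , zy≈0)
    with ¬∀⟶∃¬ _ (λ i → Fᵢ._≈_ i (y i) (Fᵢ.0# i)) (λ i → Fᵢ._≈?_ i _ _) y≉0
  ... | i , yᵢ≉0 = i , Fᵢ.x*y≈0⇒x≈0 i (zy≈0 i) yᵢ≉0

  Tuple : Set
  Tuple = (j : Fin (suc n′)) → Fin (tailSize j)

  tupleColouring : (tuple : Elt → Tuple) → (∀ {x y} → x ≈ᴾ y → ∀ j → tuple x j ≡ tuple y j) →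
                   (∀ {x y} → (∀ j → tuple x j ≡ tuple y j) → ¬ Adjacent x y) → ProperColouring (∏ tailSize)
  tupleColouring tuple tuple-cong tuple-proper = record
    { colour   = encode tailSize ∘ tuple
    ; respects = encode-cong tailSize ∘ tuple-cong
    ; proper   = λ adjacent same → tuple-proper (encode-injective tailSize same) adjacent
    }

  clique : Fin (∏ tailSize) → Elt
  clique a zero    = Fᵢ.0# zero
  clique a (suc j) = Fᵢ.decode (suc j) (decode tailSize a j)

  clique-adjacent : ∀ {a b} → a ≢ b → Adjacent (clique a) (clique b)
  clique-adjacent {a} {b} a≢b = distinct , (unit , unit≉0 , annihilates)
    where
    distinct : ¬ clique a ≈ᴾ clique b
    distinct a≈b = a≢b (trans (sym (encode-decode tailSize a))
      (trans (encode-cong tailSize (λ j → Fᵢ.decode-injective (suc j) (a≈b (suc j)))) (encode-decode tailSize b)))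

    unit : Elt
    unit zero    = Fᵢ.1# zero
    unit (suc j) = Fᵢ.0# (suc j)

    unit≉0 : ¬ unit ≈ᴾ 0ᴾ
    unit≉0 unit≈0 = Fᵢ.1≉0 zero (unit≈0 zero)

    annihilates : ((clique a +ᴾ clique b) *ᴾ unit) ≈ᴾ 0ᴾ
    annihilates zero    = Fᵢ.trans zero (Fᵢ.*-identityʳ zero _) (Fᵢ.+-identityˡ zero _)
    annihilates (suc j) = Fᵢ.zeroʳ (suc j) _

  fewer-colours-improper : ∀ k → k < ∏ tailSize → ¬ ProperColouring k
  fewer-colours-improper k k<∏ χ with pigeonhole k<∏ (ProperColouring.colour χ ∘ clique)
  ... | a , b , a<b , same = ProperColouring.proper χ (clique-adjacent (λ a≡b → <-irrefl a≡b a<b)) same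

  chromaticNumber : ProperColouring (∏ tailSize) →
                    ChromaticNumberIs (product (map (λ i → ∣ F i ∣) (drop 1 (allFin (suc (suc n′))))))
  chromaticNumber χ =
    subst ChromaticNumberIs (sym (cong product (map-tabulate suc (λ i → ∣ F i ∣)))) (χ , fewer-colours-improper)

  pairColouring⇒properColouring : ∀ {L} → PairColouring (F zero) (F (suc zero)) L →
                                  (∀ j → RowColourings (F (suc (suc j))) L) → ProperColouring (∏ tailSize)
  pairColouring⇒properColouring {L} P rows = tupleColouring tuple tuple-cong tuple-proper
    where
    module P = PairColouring P
    module R (j : Fin n′) = RowColourings (rows j)

    label : Elt → Fin L
    label x = P.label (x zero) (x (suc zero))

    tuple : Elt → Tuple
    tuple x zero    = P.colour (x zero) (x (suc zero))
    tuple x (suc j) = R.colour j (label x) (x (suc (suc j)))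

    tuple-cong : ∀ {x y} → x ≈ᴾ y → ∀ j → tuple x j ≡ tuple y j
    tuple-cong x≈y zero    = P.colour-cong (x≈y zero) (x≈y (suc zero))
    tuple-cong x≈y (suc j) = trans (cong (λ r → R.colour j r _) (P.label-cong (x≈y zero) (x≈y (suc zero))))
                                   (R.colour-cong j _ (x≈y (suc (suc j))))

    tuple-proper : ∀ {x y} → (∀ j → tuple x j ≡ tuple y j) → ¬ Adjacent x y
    tuple-proper {x} {y} same (x≉y , x+y∈Z) with label x ≟ label y
    ... | yes label≡ = x≉y x≈y
      where
      head≈ : Fᵢ._≈_ zero (x zero) (y zero) × Fᵢ._≈_ (suc zero) (x (suc zero)) (y (suc zero))
      head≈ = P.injective (same zero) label≡

      x≈y : x ≈ᴾ y
      x≈y zero          = proj₁ head≈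
      x≈y (suc zero)    = proj₂ head≈
      x≈y (suc (suc j)) = R.colour-injective j (label x) (trans (same (suc j)) (cong (λ r → R.colour j r _) (sym label≡)))
    ... | no label≢ with zeroDivisor⇒zeroCoordinate x+y∈Z
    ...   | zero        , sum≈0 = label≢ (P.separates (same zero) (inj₁ sum≈0))
    ...   | suc zero    , sum≈0 = label≢ (P.separates (same zero) (inj₂ sum≈0))
    ...   | suc (suc j) , sum≈0 = label≢ (R.colour-separates j (same (suc j)) sum≈0)

open FieldLemmas
open FieldColourings

mainTheorem6 : ∀ {c ℓ : Level} (n : ℕ) (2≤n : 2 ≤ n) (F : Fin n → FiniteField c ℓ)
    → (∀ i j → toℕ i ≤ toℕ j → ∣ F i ∣ ≤ ∣ F j ∣)
    → (EvenCharacteristic (FiniteField.field' (F (fromℕ< (≤-trans (n≤1+n 1) 2≤n))))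
       ⊎ ((∀ i → OddCharacteristic (FiniteField.field' (F i)))
          × ¬ ((F (fromℕ< (≤-trans (n≤1+n 1) 2≤n)) , F (fromℕ< 2≤n)) ≅Z3×Z3)))
    → Product.ChromaticNumberIs F (product (map (λ i → ∣ F i ∣) (drop 1 (allFin n))))
mainTheorem6 {c} {ℓ} (suc (suc n′)) (s≤s (s≤s z≤n)) F mono (inj₁ even) =
  chromaticNumber (pairColouring⇒properColouring (evenPairColouring F₀ F₁ two≈0 (rows zero)) (rows ∘ suc))
  where
  open ProductColouring F

  F₀ F₁ : FiniteField c ℓ
  F₀ = F zero
  F₁ = F (suc zero)

  two≈0 : CharacteristicTwo F₀
  two≈0 = FiniteFieldProperties.even⇒two≈0 F₀ even

  rows : ∀ j → RowColourings (F (suc j)) ∣ F₀ ∣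
  rows j = rowColourings (F (suc j)) |F₀|≤ (even⇒separableRows F₀ (F (suc j)) two≈0 |F₀|≤)
    where
    |F₀|≤ : ∣ F₀ ∣ ≤ ∣ F (suc j) ∣
    |F₀|≤ = mono zero (suc j) z≤n
mainTheorem6 {c} {ℓ} (suc (suc n′)) (s≤s (s≤s z≤n)) F mono (inj₂ (odd , ¬≅ℤ₃×ℤ₃)) =
  chromaticNumber
    (pairColouring⇒properColouring (oddPairColouring F₀ F₁ two₀≉0 two₁≉0 |F₀|≤|F₁| 5≤|F₁|) rows)
  where
  open ProductColouring F

  F₀ F₁ : FiniteField c ℓ
  F₀ = F zero
  F₁ = F (suc zero)

  two₀≉0 : ¬ CharacteristicTwo F₀
  two₀≉0 = FiniteFieldProperties.odd⇒two≉0 F₀ (odd zero)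

  two₁≉0 : ¬ CharacteristicTwo F₁
  two₁≉0 = FiniteFieldProperties.odd⇒two≉0 F₁ (odd (suc zero))

  |F₀|≤|F₁| : ∣ F₀ ∣ ≤ ∣ F₁ ∣
  |F₀|≤|F₁| = mono zero (suc zero) z≤n

  5≤|F₁| : 5 ≤ ∣ F₁ ∣
  5≤|F₁| = ¬≅ℤ₃×ℤ₃⇒5≤∣G∣ F₀ F₁ two₀≉0 two₁≉0 |F₀|≤|F₁| ¬≅ℤ₃×ℤ₃

  rows : ∀ j → RowColourings (F (suc (suc j))) ∣ F₁ ∣
  rows j = rowColourings (F (suc (suc j))) |F₁|≤ (inj₂ (inj₁ (≤-trans 5≤|F₁| |F₁|≤)))
    where
    |F₁|≤ : ∣ F₁ ∣ ≤ ∣ F (suc (suc j)) ∣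
    |F₁|≤ = mono (suc zero) (suc (suc j)) (s≤s z≤n)
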